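{- Let $m,n\ge1$ and let $(u_{i,j})$ be a positive integral $(m,n)$-periodic $SL_2$-tiling. Then for all $i,j\in\mathbb Z$, $u_{i,j}$ divides $u_{i-1,j}+u_{i+1,j}$ and $u_{i,j-1}+u_{i,j+1}$. Moreover, $\frac{u_{i,j-1}+u_{i,j+1}}{u_{i,j}}$ does not depend on $i$, and $\frac{u_{i-1,j}+u_{i+1,j}}{u_{i,j}}$ does not depend on $j$.
   Context: An $SL_2$-tiling is a family $(u_{i,j})_{i,j\in\mathbb Z}$ of reals with $u_{i+1,j}u_{i,j+1}-u_{i,j}u_{i+1,j+1}=1$ for all $i,j$; positive integral if all entries are positive integers; $(m,n)$-periodic if $u_{i+m,j+n}=u_{i,j}$ for all $i,j$. -}

module Defs where

open import Data.Integer using (ℤ; +_; _+_; _-_; _*_; _<_; 0ℤ; 1ℤ)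
open import Relation.Binary.PropositionalEquality using (_≡_)
open import Data.Nat using (ℕ)

IsSL2Tiling : (ℤ → ℤ → ℤ) → Set
IsSL2Tiling u = ∀ i j →
  u (i + 1ℤ) j * u i (j + 1ℤ) - u i j * u (i + 1ℤ) (j + 1ℤ) ≡ 1ℤ

IsPositive : (ℤ → ℤ → ℤ) → Set
IsPositive u = ∀ i j → 0ℤ < u i j

IsPeriodic : ℕ → ℕ → (ℤ → ℤ → ℤ) → Set
IsPeriodic m n u = ∀ i j → u (i + + m) (j + + n) ≡ u i j

{-# OPTIONS --safe #-}
module Submission where

open import Defs
open import Data.Nat using (ℕ; _≥_)
open import Data.Integer using (ℤ; _+_; _-_; _*_; 1ℤ)
open import Data.Integer.Divisibility using (_∣_)
open import Data.Product using (_×_; ∃)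
open import Relation.Binary.PropositionalEquality using (_≡_)

open import Data.Nat using (zero; suc)
open import Data.Integer as ℤ using (+_; -[1+_]; +[1+_]; 0ℤ; -1ℤ; NonZero; >-nonZero)
open import Data.Integer.Properties using (+-comm; *-comm; *-assoc; *-identityʳ; i-j≡0⇒i≡j; *-cancelʳ-≡; i*j≢0)
open import Data.Integer.Divisibility.Signed using (divides; ∣⇒∣ᵤ)
open import Data.Integer.Tactic.RingSolver using (solve-∀)
open import Data.Product using (_,_)
open import Relation.Binary.PropositionalEquality using (refl; sym; trans; cong; cong₂; subst; module ≡-Reasoning)

-- In two adjacent rows  x y z / x' y' z'  of an SL₂-tiling both 2×2 minors equal 1,
-- and (x + z) y' − (x' + z') y is their difference, hence 0: the ratio (x + z) / y
-- is the same in every row.  Multiplying x + z by the right minor y' z − y z' = 1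
-- and using this gives x + z = ((x' + z') z − (x + z) z') y, an integral quotient.
-- Columns follow by transposing.  Positivity is only used to cancel nonzero
-- entries, and periodicity is not needed at all.

module UnimodularWindow (x y z x' y' z' : ℤ)
  (left : x' * y - x * y' ≡ 1ℤ) (right : y' * z - y * z' ≡ 1ℤ) where

  open ≡-Reasoning

  sum-cross : (x + z) * y' ≡ (x' + z') * y
  sum-cross = i-j≡0⇒i≡j _ _ (begin
    (x + z) * y' - (x' + z') * y            ≡⟨ difference x y z x' y' z' ⟩
    (y' * z - y * z') - (x' * y - x * y')   ≡⟨ cong₂ _-_ right left ⟩
    1ℤ - 1ℤ                                 ≡⟨⟩
    0ℤ                                      ∎)
    where
    difference : ∀ x y z x' y' z' →
      (x + z) * y' - (x' + z') * y ≡ (y' * z - y * z') - (x' * y - x * y')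
    difference = solve-∀

  sum-quotient : x + z ≡ ((x' + z') * z - (x + z) * z') * y
  sum-quotient = begin
    x + z                                     ≡⟨ sym (*-identityʳ (x + z)) ⟩
    (x + z) * 1ℤ                              ≡⟨ cong ((x + z) *_) (sym right) ⟩
    (x + z) * (y' * z - y * z')               ≡⟨ expand (x + z) y z y' z' ⟩
    ((x + z) * y') * z - (x + z) * z' * y     ≡⟨ cong (λ w → w * z - (x + z) * z' * y) sum-cross ⟩
    ((x' + z') * y) * z - (x + z) * z' * y    ≡⟨ collect (x' + z') (x + z) y z z' ⟩
    ((x' + z') * z - (x + z) * z') * y        ∎
    where
    expand : ∀ s y z y' z' → s * (y' * z - y * z') ≡ (s * y') * z - s * z' * y
    expand = solve-∀
    collect : ∀ s' s y z z' → (s' * y) * z - s * z' * y ≡ (s' * z - s * z') * y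
    collect = solve-∀

succ-invariant⇒constant : {A : Set} (f : ℤ → A) → (∀ i → f (i + 1ℤ) ≡ f i) → ∀ i → f i ≡ f 0ℤ
succ-invariant⇒constant f invariant = go
  where
  invariant′ : ∀ i → f (ℤ.suc i) ≡ f i
  invariant′ i = trans (cong f (+-comm 1ℤ i)) (invariant i)
  go : ∀ i → f i ≡ f 0ℤ
  go (+ zero)        = refl
  go +[1+ n ]        = trans (invariant′ (+ n)) (go (+ n))
  go -[1+ zero ]     = sym (invariant′ -1ℤ)
  go -[1+ suc n ]    = trans (sym (invariant′ -[1+ suc n ])) (go -[1+ n ])

rowSum : (ℤ → ℤ → ℤ) → ℤ → ℤ → ℤ
rowSum u i j = u i (j - 1ℤ) + u i (j + 1ℤ)

rowQuotient : (ℤ → ℤ → ℤ) → ℤ → ℤ → ℤ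
rowQuotient u i j = rowSum u (i + 1ℤ) j * u i (j + 1ℤ) - rowSum u i j * u (i + 1ℤ) (j + 1ℤ)

transpose : (ℤ → ℤ → ℤ) → ℤ → ℤ → ℤ
transpose u i j = u j i

transpose-IsSL2Tiling : ∀ u → IsSL2Tiling u → IsSL2Tiling (transpose u)
transpose-IsSL2Tiling u tiling i j =
  trans (cong (_- u j i * u (j + 1ℤ) (i + 1ℤ)) (*-comm (u j (i + 1ℤ)) (u (j + 1ℤ) i)))
        (tiling j i)

module _ (u : ℤ → ℤ → ℤ) (tiling : IsSL2Tiling u) where

  private
    leftMinor : ∀ i j → u (i + 1ℤ) (j - 1ℤ) * u i j - u i (j - 1ℤ) * u (i + 1ℤ) j ≡ 1ℤ
    leftMinor i j = subst (λ k → u (i + 1ℤ) (j - 1ℤ) * u i k - u i (j - 1ℤ) * u (i + 1ℤ) k ≡ 1ℤ)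
                          (j-1+1≡j j) (tiling i (j - 1ℤ))
      where
      j-1+1≡j : ∀ j → j - 1ℤ + 1ℤ ≡ j
      j-1+1≡j = solve-∀

    module Window (i j : ℤ) = UnimodularWindow
      (u i (j - 1ℤ)) (u i j) (u i (j + 1ℤ)) (u (i + 1ℤ) (j - 1ℤ)) (u (i + 1ℤ) j) (u (i + 1ℤ) (j + 1ℤ))
      (leftMinor i j) (tiling i j)

  rowSum≡rowQuotient*u : ∀ i j → rowSum u i j ≡ rowQuotient u i j * u i j
  rowSum≡rowQuotient*u i j = Window.sum-quotient i j

  u∣rowSum : ∀ i j → u i j ∣ rowSum u i j
  u∣rowSum i j = ∣⇒∣ᵤ (divides (rowQuotient u i j) (rowSum≡rowQuotient*u i j))

  rowSum-cross : ∀ i j → rowSum u i j * u (i + 1ℤ) j ≡ rowSum u (i + 1ℤ) j * u i j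
  rowSum-cross i j = Window.sum-cross i j

  module _ (nonZero : ∀ i j → NonZero (u i j)) where

    rowQuotient-succ : ∀ j i → rowQuotient u (i + 1ℤ) j ≡ rowQuotient u i j
    rowQuotient-succ j i =
      *-cancelʳ-≡ q′ q (y * y′) {{i*j≢0 y y′ {{nonZero i j}} {{nonZero (i + 1ℤ) j}}}} (begin
        q′ * (y * y′)                 ≡⟨ regroup q′ y′ y ⟩
        (q′ * y′) * y                 ≡⟨ cong (_* y) (sym (rowSum≡rowQuotient*u (i + 1ℤ) j)) ⟩
        rowSum u (i + 1ℤ) j * y       ≡⟨ sym (rowSum-cross i j) ⟩
        rowSum u i j * y′             ≡⟨ cong (_* y′) (rowSum≡rowQuotient*u i j) ⟩
        (q * y) * y′                  ≡⟨ *-assoc q y y′ ⟩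
        q * (y * y′)                  ∎)
      where
      open ≡-Reasoning
      y  = u i j
      y′ = u (i + 1ℤ) j
      q  = rowQuotient u i j
      q′ = rowQuotient u (i + 1ℤ) j
      regroup : ∀ a b c → a * (c * b) ≡ (a * b) * c
      regroup = solve-∀

    rowSum-proportional : ∃ λ (a : ℤ → ℤ) → ∀ i j → rowSum u i j ≡ a j * u i j
    rowSum-proportional = (rowQuotient u 0ℤ) , λ i j →
      trans (rowSum≡rowQuotient*u i j)
            (cong (_* u i j) (succ-invariant⇒constant (λ k → rowQuotient u k j) (rowQuotient-succ j) i))

corollary6p2 : (m n : ℕ) → m ≥ 1 → n ≥ 1 → (u : ℤ → ℤ → ℤ) →
    IsSL2Tiling u → IsPositive u → IsPeriodic m n u →
    ((∀ i j → u i j ∣ (u (i - 1ℤ) j + u (i + 1ℤ) j))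
      × (∀ i j → u i j ∣ (u i (j - 1ℤ) + u i (j + 1ℤ))))
    × ((∃ λ (a : ℤ → ℤ) → ∀ i j → u i (j - 1ℤ) + u i (j + 1ℤ) ≡ a j * u i j)
      × (∃ λ (b : ℤ → ℤ) → ∀ i j → u (i - 1ℤ) j + u (i + 1ℤ) j ≡ b i * u i j))
corollary6p2 _ _ _ _ u tiling positive _ =
  ((λ i j → u∣rowSum (transpose u) tilingᵀ j i) , u∣rowSum u tiling) ,
  (rowSum-proportional u tiling nonZero , columnSum-proportional)
  where
  tilingᵀ : IsSL2Tiling (transpose u)
  tilingᵀ = transpose-IsSL2Tiling u tiling

  nonZero : ∀ i j → NonZero (u i j)
  nonZero i j = >-nonZero (positive i j)

  columnSum-proportional : ∃ λ (b : ℤ → ℤ) → ∀ i j → u (i - 1ℤ) j + u (i + 1ℤ) j ≡ b i * u i j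
  columnSum-proportional =
    let b , proportional = rowSum-proportional (transpose u) tilingᵀ (λ i j → nonZero j i)
    in  b , λ i j → proportional j i
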